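{- For any query-type execution sequence $E$ and any integer block size $B\ge1$, $\widetilde{C}_B(E)=J_{\ell_B}(E)$, where $\ell_B(d)=\min(1,d/B)$.
   Context: An execution sequence is a finite sequence $E=(e_0,e_1,\dots,e_m)$ of integers, $|E|=m$; it is query-type if $e_0\le e_1\le\dots\le e_m$. For a function $\ell$ on nonnegative integers, the locality-of-reference (LoR) cost is $J_\ell(E)=\sum_{i=1}^{m}\ell(|e_i-e_{i-1}|)$. The cache-oblivious cost with block size $B$ is $C_B(E)=\sum_{i=1}^{m}[\lfloor e_i/B\rfloor\neq\lfloor e_{i-1}/B\rfloor]$, and the smoothed cost is $\widetilde{C}_B(E)=\mathbb{E}_s[C_B((e_0+s,\dots,e_m+s))]$ with $s$ uniform in $\{0,\dots,B-1\}$. -}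

module Defs where

open import Data.Nat using (ℕ; zero; suc; NonZero) renaming (_+_ to _+ℕ_; _<_ to _<ℕ_)
open import Data.Integer using (ℤ; +_; _-_; ∣_∣; _≤_; _/ℕ_; _≟_; _+_)
open import Data.Rational using (ℚ; _/_; 1ℚ; _⊓_) renaming (_+_ to _+ℚ_; 0ℚ to 0q)
open import Data.Bool using (if_then_else_)
open import Relation.Nullary.Decidable using (does)

-- An execution sequence E = (e_0, ..., e_m) is represented by its length m
-- together with a function e : ℕ → ℤ; only the values e 0, ..., e m are used.

sumℕ : ℕ → (ℕ → ℕ) → ℕ
sumℕ zero    f = 0
sumℕ (suc n) f = sumℕ n f +ℕ f n

sumℚ : ℕ → (ℕ → ℚ) → ℚ
sumℚ zero    f = 0q
sumℚ (suc n) f = sumℚ n f +ℚ f n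

QueryType : (m : ℕ) → (ℕ → ℤ) → Set
QueryType m e = ∀ i → i <ℕ m → e i ≤ e (suc i)

J : (ℕ → ℚ) → (m : ℕ) → (ℕ → ℤ) → ℚ
J ℓ m e = sumℚ m (λ i → ℓ ∣ e (suc i) - e i ∣)

block : (B : ℕ) .{{_ : NonZero B}} → ℤ → ℤ
block B x = x /ℕ B

C : (B : ℕ) .{{_ : NonZero B}} → (m : ℕ) → (ℕ → ℤ) → ℕ
C B m e = sumℕ m (λ i → if does (block B (e (suc i)) ≟ block B (e i)) then 0 else 1)

Ctilde : (B : ℕ) .{{_ : NonZero B}} → (m : ℕ) → (ℕ → ℤ) → ℚ
Ctilde B m e = (+ sumℕ B (λ s → C B m (λ i → e i + + s))) / B

ℓ : (B : ℕ) .{{_ : NonZero B}} → ℕ → ℚ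
ℓ B d = 1ℚ ⊓ ((+ d) / B)

-- A query step jumps from a to a + d with d ≥ 0. Writing a = qB + r, the shifted
-- step crosses a block boundary exactly when the natural-number interval
-- [r + s, r + s + d] does. That indicator is B-periodic in r + s, so its sum over the
-- B shifts s is the same as for r = 0, where it counts the s < B with s + d ≥ B,
-- i.e. min(B, d). Dividing by B and summing over the steps gives J_{ℓ_B}(E).
module Submission where

open import Defs
open import Algebra.Properties.AbelianGroup as AbelianGroupProperties using ()
open import Algebra.Properties.CommutativeSemigroup as CommutativeSemigroupProperties using ()
open import Data.Integer as ℤ using (ℤ; +_; ∣_∣; _/ℕ_; _%ℕ_)
import Data.Integer.DivMod as ℤ
import Data.Integer.Properties as ℤ
open import Data.Integer.Solver using (module +-*-Solver)
open import Data.Nat as ℕ using (ℕ; zero; suc; NonZero; _+_; _∸_; _⊓_; _≤_; _<_; _<?_)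
import Data.Nat.DivMod as ℕ
import Data.Nat.Properties as ℕ
open import Data.Rational as ℚ using (ℚ; _/_; 1ℚ) renaming (_+_ to _+ℚ_)
import Data.Rational.Properties as ℚ
import Data.Rational.Unnormalised as ℚᵘ
import Data.Rational.Unnormalised.Properties as ℚᵘ
open import Data.Bool using (if_then_else_)
open import Data.Sum using (inj₁; inj₂)
open import Function using (_∘_; _⇔_; mk⇔)
open import Relation.Nullary using (Dec; ¬_)
open import Relation.Nullary.Decidable using (does; does-⇔; dec-true; dec-false)
open import Relation.Binary.PropositionalEquality hiding (J)
open ≡-Reasoning

open AbelianGroupProperties ℤ.+-0-abelianGroup using (∙-cancelʳ)
open CommutativeSemigroupProperties ℕ.+-commutativeSemigroup
  using () renaming (interchange to +-interchange; xy∙z≈xz∙y to +-right-comm)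
open CommutativeSemigroupProperties ℤ.+-commutativeSemigroup
  using () renaming (xy∙z≈xz∙y to +ℤ-right-comm)
open +-*-Solver using (solve; _:+_; _:-_; _:*_; _:=_; con)

sumℕ-cong : ∀ n {f g : ℕ → ℕ} → (∀ i → i < n → f i ≡ g i) → sumℕ n f ≡ sumℕ n g
sumℕ-cong zero    f≡g = refl
sumℕ-cong (suc n) f≡g = cong₂ _+_ (sumℕ-cong n (λ i i<n → f≡g i (ℕ.m<n⇒m<1+n i<n))) (f≡g n ℕ.≤-refl)

sumℚ-cong : ∀ n {f g : ℕ → ℚ} → (∀ i → f i ≡ g i) → sumℚ n f ≡ sumℚ n g
sumℚ-cong zero    f≡g = refl
sumℚ-cong (suc n) f≡g = cong₂ _+ℚ_ (sumℚ-cong n f≡g) (f≡g n)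

sumℕ-suc : ∀ n (f : ℕ → ℕ) → sumℕ (suc n) f ≡ f 0 + sumℕ n (f ∘ suc)
sumℕ-suc zero    f = ℕ.+-comm 0 (f 0)
sumℕ-suc (suc n) f = trans (cong (_+ f (suc n)) (sumℕ-suc n f)) (ℕ.+-assoc (f 0) _ _)

sumℕ-zero : ∀ n → sumℕ n (λ _ → 0) ≡ 0
sumℕ-zero zero    = refl
sumℕ-zero (suc n) = trans (ℕ.+-identityʳ _) (sumℕ-zero n)

sumℕ-distrib-+ : ∀ n (f g : ℕ → ℕ) → sumℕ n (λ i → f i + g i) ≡ sumℕ n f + sumℕ n g
sumℕ-distrib-+ zero    f g = refl
sumℕ-distrib-+ (suc n) f g = trans (cong (_+ (f n + g n)) (sumℕ-distrib-+ n f g))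
                                   (+-interchange (sumℕ n f) (sumℕ n g) (f n) (g n))

sumℕ-swap : ∀ n m (h : ℕ → ℕ → ℕ) →
            sumℕ n (λ s → sumℕ m (h s)) ≡ sumℕ m (λ i → sumℕ n (λ s → h s i))
sumℕ-swap n zero    h = sumℕ-zero n
sumℕ-swap n (suc m) h = trans (sumℕ-distrib-+ n (λ s → sumℕ m (h s)) (λ s → h s m))
                              (cong (_+ sumℕ n (λ s → h s m)) (sumℕ-swap n m h))

sumℕ-periodic-window : ∀ p {f : ℕ → ℕ} → (∀ n → f (n + p) ≡ f n) →
                       ∀ r → sumℕ p (λ s → f (r + s)) ≡ sumℕ p f
sumℕ-periodic-window p {f} periodic zero    = refl
sumℕ-periodic-window p {f} periodic (suc r) =
  trans window-step (sumℕ-periodic-window p periodic r)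
  where
  W : ℕ → ℕ
  W r = sumℕ p (λ s → f (r + s))

  window-step : W (suc r) ≡ W r
  window-step = ℕ.+-cancelˡ-≡ (f r) _ _ (begin
    f r + W (suc r)                        ≡⟨ cong₂ _+_ (cong f (ℕ.+-identityʳ r))
                                                (sumℕ-cong p (λ s _ → cong f (ℕ.+-suc r s))) ⟨
    f (r + 0) + sumℕ p (λ s → f (r + suc s)) ≡⟨ sumℕ-suc p (λ s → f (r + s)) ⟨
    W r + f (r + p)                        ≡⟨ cong (λ x → W r + x) (periodic r) ⟩
    W r + f r                              ≡⟨ ℕ.+-comm (W r) (f r) ⟩
    f r + W r                              ∎)

[¬_] : ∀ {a} {A : Set a} → Dec A → ℕ
[¬ p ] = if does p then 0 else 1

[¬]-cong : ∀ {a b} {A : Set a} {A′ : Set b} → A ⇔ A′ →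
           (p : Dec A) (p′ : Dec A′) → [¬ p ] ≡ [¬ p′ ]
[¬]-cong A⇔A′ p p′ = cong (λ b → if b then 0 else 1) (does-⇔ A⇔A′ p p′)

[¬]-yes : ∀ {a} {A : Set a} → A → (p : Dec A) → [¬ p ] ≡ 0
[¬]-yes a p = cong (λ b → if b then 0 else 1) (dec-true p a)

[¬]-no : ∀ {a} {A : Set a} → ¬ A → (p : Dec A) → [¬ p ] ≡ 1
[¬]-no ¬a p = cong (λ b → if b then 0 else 1) (dec-false p ¬a)

sumℕ-threshold : ∀ k d c → sumℕ k (λ s → [¬ s + d <? c ]) ≡ k ∸ (c ∸ d)
sumℕ-threshold zero    d c = sym (ℕ.0∸n≡0 (c ∸ d))
sumℕ-threshold (suc k) d c with ℕ.<-≤-connex (k + d) c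
... | inj₁ k+d<c = begin
  sumℕ k (λ s → [¬ s + d <? c ]) + [¬ k + d <? c ]
    ≡⟨ cong₂ _+_ (sumℕ-threshold k d c) ([¬]-yes k+d<c (k + d <? c)) ⟩
  k ∸ (c ∸ d) + 0                                    ≡⟨ ℕ.+-identityʳ _ ⟩
  k ∸ (c ∸ d)                                        ≡⟨ ℕ.m≤n⇒m∸n≡0 (ℕ.<⇒≤ 1+k≤c∸d) ⟩
  0                                                  ≡⟨ ℕ.m≤n⇒m∸n≡0 1+k≤c∸d ⟨
  suc k ∸ (c ∸ d)                                    ∎
  where
  1+k≤c∸d : suc k ≤ c ∸ d
  1+k≤c∸d = ℕ.m+n≤o⇒m≤o∸n (suc k) k+d<c
... | inj₂ c≤k+d = begin
  sumℕ k (λ s → [¬ s + d <? c ]) + [¬ k + d <? c ]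
    ≡⟨ cong₂ _+_ (sumℕ-threshold k d c) ([¬]-no (ℕ.≤⇒≯ c≤k+d) (k + d <? c)) ⟩
  k ∸ (c ∸ d) + 1                                    ≡⟨ ℕ.+-comm _ 1 ⟩
  1 + (k ∸ (c ∸ d))                                  ≡⟨ ℕ.+-∸-assoc 1 c∸d≤k ⟨
  suc k ∸ (c ∸ d)                                    ∎
  where
  c∸d≤k : c ∸ d ≤ k
  c∸d≤k = ℕ.m≤n+o⇒m∸n≤o c d (ℕ.≤-trans c≤k+d (ℕ.≤-reflexive (ℕ.+-comm k d)))

m∸[m∸n]≡m⊓n : ∀ m n → m ∸ (m ∸ n) ≡ m ⊓ n
m∸[m∸n]≡m⊓n m n with ℕ.≤-total n m
... | inj₁ n≤m = trans (ℕ.m∸[m∸n]≡n n≤m) (sym (ℕ.m≥n⇒m⊓n≡n n≤m))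
... | inj₂ m≤n = trans (cong (m ∸_) (ℕ.m≤n⇒m∸n≡0 m≤n)) (sym (ℕ.m≤n⇒m⊓n≡m m≤n))

[m+n]/n≡1+m/n : ∀ m n .{{_ : NonZero n}} → (m + n) ℕ./ n ≡ suc (m ℕ./ n)
[m+n]/n≡1+m/n m n = trans (ℕ.m/n≡1+[m∸n]/n (ℕ.m≤n+m n m)) (cong (suc ∘ (ℕ._/ n)) (ℕ.m+n∸n≡m m n))

module _ (B : ℕ) .{{_ : NonZero B}} (d : ℕ) where

  crossing : ℕ → ℕ
  crossing n = [¬ (n + d) ℕ./ B ℕ.≟ n ℕ./ B ]

  crossing-periodic : ∀ n → crossing (n + B) ≡ crossing n
  crossing-periodic n = cong₂ (λ x y → [¬ x ℕ.≟ y ])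
    (trans (cong (ℕ._/ B) (+-right-comm n B d)) ([m+n]/n≡1+m/n (n + d) B))
    ([m+n]/n≡1+m/n n B)

  crossing-in-first-block : ∀ {s} → s < B → crossing s ≡ [¬ s + d <? B ]
  crossing-in-first-block {s} s<B =
    [¬]-cong (mk⇔ to from) ((s + d) ℕ./ B ℕ.≟ s ℕ./ B) (s + d <? B)
    where
    s/B≡0 : s ℕ./ B ≡ 0
    s/B≡0 = ℕ.m<n⇒m/n≡0 s<B
    to : (s + d) ℕ./ B ≡ s ℕ./ B → s + d < B
    to eq = ℕ.m/n≡0⇒m<n (trans eq s/B≡0)
    from : s + d < B → (s + d) ℕ./ B ≡ s ℕ./ B
    from s+d<B = trans (ℕ.m<n⇒m/n≡0 s+d<B) (sym s/B≡0)

  sumℕ-crossing-window : ∀ r → sumℕ B (λ s → crossing (r + s)) ≡ B ⊓ d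
  sumℕ-crossing-window r = begin
    sumℕ B (λ s → crossing (r + s)) ≡⟨ sumℕ-periodic-window B crossing-periodic r ⟩
    sumℕ B crossing                 ≡⟨ sumℕ-cong B (λ s → crossing-in-first-block) ⟩
    sumℕ B (λ s → [¬ s + d <? B ])  ≡⟨ sumℕ-threshold B d B ⟩
    B ∸ (B ∸ d)                     ≡⟨ m∸[m∸n]≡m⊓n B d ⟩
    B ⊓ d                           ∎

i<1+j⇒i≤j : ∀ {i j} → i ℤ.< ℤ.suc j → i ℤ.≤ j
i<1+j⇒i≤j {i} {j} i<1+j = subst (i ℤ.≤_) (ℤ.pred-suc j) (ℤ.i<j⇒i≤pred[j] i<1+j)

/ℕ-unique : ∀ {i q} d .{{_ : NonZero d}} →
            q ℤ.* + d ℤ.≤ i → i ℤ.< ℤ.suc q ℤ.* + d → i /ℕ d ≡ q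
/ℕ-unique {i} {q} d@(suc _) lower upper = ℤ.≤-antisym
  (i<1+j⇒i≤j (ℤ.*-cancelʳ-<-nonNeg (+ d) (ℤ.≤-<-trans (ℤ.[n/ℕd]*d≤n i d) upper)))
  (i<1+j⇒i≤j (ℤ.*-cancelʳ-<-nonNeg (+ d) (ℤ.≤-<-trans lower (ℤ.n<s[n/ℕd]*d i d))))

[i+k*d]/ℕd≡i/ℕd+k : ∀ i k d .{{_ : NonZero d}} → (i ℤ.+ k ℤ.* + d) /ℕ d ≡ i /ℕ d ℤ.+ k
[i+k*d]/ℕd≡i/ℕd+k i k d = /ℕ-unique d lower upper
  where
  q : ℤ
  q = i /ℕ d
  lower : (q ℤ.+ k) ℤ.* + d ℤ.≤ i ℤ.+ k ℤ.* + d
  lower = subst (ℤ._≤ i ℤ.+ k ℤ.* + d) (sym (ℤ.*-distribʳ-+ (+ d) q k))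
                (ℤ.+-monoˡ-≤ (k ℤ.* + d) (ℤ.[n/ℕd]*d≤n i d))
  upper : i ℤ.+ k ℤ.* + d ℤ.< ℤ.suc (q ℤ.+ k) ℤ.* + d
  upper = subst (i ℤ.+ k ℤ.* + d ℤ.<_)
                (solve 3 (λ q k d → (con (+ 1) :+ q) :* d :+ k :* d := (con (+ 1) :+ (q :+ k)) :* d)
                       refl q k (+ d))
                (ℤ.+-monoˡ-< (k ℤ.* + d) (ℤ.n<s[n/ℕd]*d i d))

block-+ : ∀ B .{{_ : NonZero B}} a t → block B (a ℤ.+ + t) ≡ + ((a %ℕ B + t) ℕ./ B) ℤ.+ block B a
block-+ B a t = trans (cong (_/ℕ B) a+t≡) ([i+k*d]/ℕd≡i/ℕd+k (+ (a %ℕ B + t)) (a /ℕ B) B)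
  where
  a+t≡ : a ℤ.+ + t ≡ + (a %ℕ B + t) ℤ.+ a /ℕ B ℤ.* + B
  a+t≡ = begin
    a ℤ.+ + t                                     ≡⟨ cong (ℤ._+ + t) (ℤ.a≡a%ℕn+[a/ℕn]*n a B) ⟩
    + (a %ℕ B) ℤ.+ a /ℕ B ℤ.* + B ℤ.+ + t         ≡⟨ +ℤ-right-comm (+ (a %ℕ B)) (a /ℕ B ℤ.* + B) (+ t) ⟩
    + (a %ℕ B) ℤ.+ + t ℤ.+ a /ℕ B ℤ.* + B         ≡⟨ cong (ℤ._+ a /ℕ B ℤ.* + B) (ℤ.pos-+ (a %ℕ B) t) ⟨
    + (a %ℕ B + t) ℤ.+ a /ℕ B ℤ.* + B             ∎

shifted-crossing : ∀ B .{{_ : NonZero B}} a d s →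
                   [¬ block B (a ℤ.+ + d ℤ.+ + s) ℤ.≟ block B (a ℤ.+ + s) ]
                   ≡ crossing B d (a %ℕ B + s)
shifted-crossing B a d s = [¬]-cong (mk⇔ to from)
  (block B (a ℤ.+ + d ℤ.+ + s) ℤ.≟ block B (a ℤ.+ + s)) ((r + s + d) ℕ./ B ℕ.≟ (r + s) ℕ./ B)
  where
  r : ℕ
  r = a %ℕ B
  q : ℤ
  q = block B a
  upper-block : block B (a ℤ.+ + d ℤ.+ + s) ≡ + ((r + s + d) ℕ./ B) ℤ.+ q
  upper-block = begin
    block B (a ℤ.+ + d ℤ.+ + s)       ≡⟨ cong (block B) (+ℤ-right-comm a (+ d) (+ s)) ⟩
    block B (a ℤ.+ + s ℤ.+ + d)       ≡⟨ cong (block B) (ℤ.+-assoc a (+ s) (+ d)) ⟩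
    block B (a ℤ.+ (+ s ℤ.+ + d))     ≡⟨ cong (λ x → block B (a ℤ.+ x)) (ℤ.pos-+ s d) ⟨
    block B (a ℤ.+ + (s + d))         ≡⟨ block-+ B a (s + d) ⟩
    + ((r + (s + d)) ℕ./ B) ℤ.+ q     ≡⟨ cong (λ n → + (n ℕ./ B) ℤ.+ q) (ℕ.+-assoc r s d) ⟨
    + ((r + s + d) ℕ./ B) ℤ.+ q       ∎
  lower-block : block B (a ℤ.+ + s) ≡ + ((r + s) ℕ./ B) ℤ.+ q
  lower-block = block-+ B a s
  to : block B (a ℤ.+ + d ℤ.+ + s) ≡ block B (a ℤ.+ + s) → (r + s + d) ℕ./ B ≡ (r + s) ℕ./ B
  to eq = ℤ.+-injective (∙-cancelʳ q _ _ (trans (sym upper-block) (trans eq lower-block)))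
  from : (r + s + d) ℕ./ B ≡ (r + s) ℕ./ B → block B (a ℤ.+ + d ℤ.+ + s) ≡ block B (a ℤ.+ + s)
  from eq = trans upper-block (trans (cong (λ n → + n ℤ.+ q) eq) (sym lower-block))

a≤b⇒b≡a+∣b-a∣ : ∀ {a b} → a ℤ.≤ b → b ≡ a ℤ.+ + ∣ b ℤ.- a ∣
a≤b⇒b≡a+∣b-a∣ {a} {b} a≤b = begin
  b                     ≡⟨ solve 2 (λ a b → b := a :+ (b :- a)) refl a b ⟩
  a ℤ.+ (b ℤ.- a)       ≡⟨ cong (λ x → a ℤ.+ x) (ℤ.0≤i⇒+∣i∣≡i (ℤ.i≤j⇒0≤j-i a≤b)) ⟨
  a ℤ.+ + ∣ b ℤ.- a ∣   ∎

smoothed-step-cost : ∀ B .{{_ : NonZero B}} {a b} → a ℤ.≤ b →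
  sumℕ B (λ s → [¬ block B (b ℤ.+ + s) ℤ.≟ block B (a ℤ.+ + s) ]) ≡ B ⊓ ∣ b ℤ.- a ∣
smoothed-step-cost B {a} {b} a≤b = begin
  sumℕ B (λ s → [¬ block B (b ℤ.+ + s) ℤ.≟ block B (a ℤ.+ + s) ])
    ≡⟨ sumℕ-cong B (λ s _ → cong (λ x → [¬ block B (x ℤ.+ + s) ℤ.≟ block B (a ℤ.+ + s) ])
                                  (a≤b⇒b≡a+∣b-a∣ a≤b)) ⟩
  sumℕ B (λ s → [¬ block B (a ℤ.+ + d ℤ.+ + s) ℤ.≟ block B (a ℤ.+ + s) ])
    ≡⟨ sumℕ-cong B (λ s _ → shifted-crossing B a d s) ⟩
  sumℕ B (λ s → crossing B d (a %ℕ B + s))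
    ≡⟨ sumℕ-crossing-window B d (a %ℕ B) ⟩
  B ⊓ d ∎
  where
  d : ℕ
  d = ∣ b ℤ.- a ∣

toℚᵘ-/ : ∀ i d .{{_ : NonZero d}} → ℚ.toℚᵘ (i / d) ℚᵘ.≃ i ℚᵘ./ d
toℚᵘ-/ i d@(suc _) = ℚ.toℚᵘ-fromℚᵘ (i ℚᵘ./ d)

/-distribʳ-+ : ∀ i j d .{{_ : NonZero d}} → (i ℤ.+ j) / d ≡ i / d +ℚ j / d
/-distribʳ-+ i j d@(suc _) = ℚ.toℚᵘ-injective
  (ℚᵘ.≃-trans (toℚᵘ-/ (i ℤ.+ j) d)
  (ℚᵘ.≃-trans (ℚᵘ.*≡* (solve 3 (λ i j d → (i :+ j) :* (d :* d) := (i :* d :+ j :* d) :* d)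
                               refl i j (+ d)))
  (ℚᵘ.≃-sym (ℚᵘ.≃-trans (ℚ.toℚᵘ-homo-+ (i / d) (j / d)) (ℚᵘ.+-cong (toℚᵘ-/ i d) (toℚᵘ-/ j d))))))

/-monoˡ-≤ : ∀ {i j} d .{{_ : NonZero d}} → i ℤ.≤ j → i / d ℚ.≤ j / d
/-monoˡ-≤ {i} {j} d@(suc _) i≤j = ℚ.toℚᵘ-cancel-≤
  (ℚᵘ.≤-respˡ-≃ (ℚᵘ.≃-sym (toℚᵘ-/ i d)) (ℚᵘ.≤-respʳ-≃ (ℚᵘ.≃-sym (toℚᵘ-/ j d))
    (ℚᵘ.*≤* (ℤ.*-monoʳ-≤-nonNeg (+ d) i≤j))))

n/n≡1 : ∀ n .{{_ : NonZero n}} → + n / n ≡ 1ℚ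
n/n≡1 n@(suc _) = ℚ.fromℚᵘ-cong {+ n ℚᵘ./ n} {ℚᵘ.1ℚᵘ}
  (ℚᵘ.*≡* (trans (ℤ.*-identityʳ (+ n)) (sym (ℤ.*-identityˡ (+ n)))))

/-distribʳ-⊓ : ∀ m n d .{{_ : NonZero d}} → + (m ⊓ n) / d ≡ (+ m / d) ℚ.⊓ (+ n / d)
/-distribʳ-⊓ m n d with ℕ.≤-total m n
... | inj₁ m≤n = trans (cong (λ k → + k / d) (ℕ.m≤n⇒m⊓n≡m m≤n))
                       (sym (ℚ.p≤q⇒p⊓q≡p (/-monoˡ-≤ d (ℤ.+≤+ m≤n))))
... | inj₂ n≤m = trans (cong (λ k → + k / d) (ℕ.m≥n⇒m⊓n≡n n≤m))
                       (sym (ℚ.p≥q⇒p⊓q≡q (/-monoˡ-≤ d (ℤ.+≤+ n≤m))))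

ℓ≡[B⊓d]/B : ∀ B .{{_ : NonZero B}} d → ℓ B d ≡ + (B ⊓ d) / B
ℓ≡[B⊓d]/B B d = begin
  1ℚ ℚ.⊓ (+ d / B)        ≡⟨ cong (λ x → x ℚ.⊓ (+ d / B)) (n/n≡1 B) ⟨
  (+ B / B) ℚ.⊓ (+ d / B) ≡⟨ /-distribʳ-⊓ B d B ⟨
  + (B ⊓ d) / B           ∎

/-distribʳ-sumℕ : ∀ m (c : ℕ → ℕ) d .{{_ : NonZero d}} → + sumℕ m c / d ≡ sumℚ m (λ i → + c i / d)
/-distribʳ-sumℕ zero    c d = ℚ.0/n≡0 d
/-distribʳ-sumℕ (suc m) c d = begin
  + (sumℕ m c + c m) / d                ≡⟨ cong (_/ d) (ℤ.pos-+ (sumℕ m c) (c m)) ⟩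
  (+ sumℕ m c ℤ.+ + c m) / d            ≡⟨ /-distribʳ-+ (+ sumℕ m c) (+ c m) d ⟩
  + sumℕ m c / d +ℚ + c m / d           ≡⟨ cong (_+ℚ + c m / d) (/-distribʳ-sumℕ m c d) ⟩
  sumℚ m (λ i → + c i / d) +ℚ + c m / d ∎

lemma5 : (B : ℕ) .{{_ : NonZero B}} (m : ℕ) (e : ℕ → ℤ) →
         QueryType m e → Ctilde B m e ≡ J (ℓ B) m e
lemma5 B m e queryType = begin
  Ctilde B m e
    ≡⟨⟩
  + sumℕ B (λ s → sumℕ m (λ i → crosses s i)) / B
    ≡⟨ cong (λ n → + n / B) (sumℕ-swap B m crosses) ⟩
  + sumℕ m (λ i → sumℕ B (λ s → crosses s i)) / B
    ≡⟨ cong (λ n → + n / B) (sumℕ-cong m (λ i i<m → smoothed-step-cost B (queryType i i<m))) ⟩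
  + sumℕ m (λ i → B ⊓ step i) / B
    ≡⟨ /-distribʳ-sumℕ m (λ i → B ⊓ step i) B ⟩
  sumℚ m (λ i → + (B ⊓ step i) / B)
    ≡⟨ sumℚ-cong m (λ i → ℓ≡[B⊓d]/B B (step i)) ⟨
  J (ℓ B) m e ∎
  where
  crosses : ℕ → ℕ → ℕ
  crosses s i = [¬ block B (e (suc i) ℤ.+ + s) ℤ.≟ block B (e i ℤ.+ + s) ]
  step : ℕ → ℕ
  step i = ∣ e (suc i) ℤ.- e i ∣
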